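{- Let $l\leq y$ be positive integers, let $a=(a_1,\ldots,a_l)$ be a non-increasing sequence of positive integers and $b=(b_1,\ldots,b_y)$ a non-increasing sequence of nonnegative integers with $a_1+\cdots+a_l=b_1+\cdots+b_y$. Let $M$ be an $l\times y$ modified Ferrers matrix for $a$. If $b$ is dominated by $c(M)$, then there exists an $l\times y$ $0$--$1$ matrix $M'=(m'_{i,j})$ whose row-sum vector is $a$, whose column-sum vector is $b$, and with $m'_{i,l-i+1}=1$ for every $i\in\{1,\dots,l\}$.
   Context: For an $l\times y$ $0$--$1$ matrix $M=(m_{i,j})$ with $y\geq l$, let $r(M)$ be its vector of row sums and $c(M)=(c_1,\dots,c_y)$ its vector of column sums. $M$ is a modified Ferrers matrix for a sequence $a=(a_1,\dots,a_l)$ of positive integers if $r(M)=a$, $m_{i,l-i+1}=1$ for every $i\in\{1,\dots,l\}$, and for all $i,j$: if $m_{i,j}=0$ then $m_{i,t}=0$ for every $t\geq j$ with $t\neq l-i+1$. For sequences $a=(a_1,\dots,a_l)$, $b=(b_1,\dots,b_y)$ with equal sums, $b$ is dominated by $a$ (written $a\unrhd b$) if $\sum_{i=1}^r a_i\geq \sum_{i=1}^r b_i$ for all positive integers $r$, where $a_i=0$ for $i>l$ and $b_i=0$ for $i>y$. -}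

module Defs where

open import Data.Nat using (ℕ; zero; suc; _+_; _∸_; _≤_)
open import Data.Fin using (Fin; toℕ) renaming (zero to fzero; suc to fsuc)
open import Data.Bool using (Bool; true; false)
open import Relation.Binary.PropositionalEquality using (_≡_)
open import Relation.Nullary using (¬_)

Matrix01 : ℕ → ℕ → Set
Matrix01 l y = Fin l → Fin y → Bool

val : Bool → ℕ
val true  = 1
val false = 0

sumF : ∀ {n} → (Fin n → ℕ) → ℕ
sumF {zero}  f = 0
sumF {suc n} f = f fzero + sumF (λ i → f (fsuc i))

rowSum : ∀ {l y} → Matrix01 l y → Fin l → ℕ
rowSum M i = sumF (λ j → val (M i j))

colSum : ∀ {l y} → Matrix01 l y → Fin y → ℕ
colSum M j = sumF (λ i → val (M i j))

ext : ∀ {n} → (Fin n → ℕ) → ℕ → ℕ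
ext {zero}  f k       = 0
ext {suc n} f zero    = f fzero
ext {suc n} f (suc k) = ext (λ i → f (fsuc i)) k

psum : ∀ {n} → (Fin n → ℕ) → ℕ → ℕ
psum f zero    = 0
psum f (suc r) = psum f r + ext f r

_⊵_ : ∀ {n m} → (Fin n → ℕ) → (Fin m → ℕ) → Set
a ⊵ b = (sumF a ≡ sumF b) × (∀ r → 1 ≤ r → psum b r ≤ psum a r)
  where open import Data.Product using (_×_)

NonIncreasing : ∀ {n} → (Fin n → ℕ) → Set
NonIncreasing {n} f = ∀ (i j : Fin n) → toℕ i ≤ toℕ j → f j ≤ f i

-- Anti-diagonal: 1-based position (i, l-i+1) is 0-based (i', l-1-i') with i' = i-1.
-- j is the anti-diagonal column of row i in an l-row matrix
IsAntiDiag : (l : ℕ) → ∀ {y} → Fin l → Fin y → Set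
IsAntiDiag l i j = toℕ j ≡ l ∸ suc (toℕ i)

HasAntiDiagOnes : ∀ {l y} → Matrix01 l y → Set
HasAntiDiagOnes {l} M = ∀ i j → IsAntiDiag l i j → M i j ≡ true

IsModifiedFerrers : ∀ {l y} → Matrix01 l y → (Fin l → ℕ) → Set
IsModifiedFerrers {l} {y} M a =
  (∀ i → rowSum M i ≡ a i) ×
  HasAntiDiagOnes M ×
  (∀ (i : Fin l) (j t : Fin y) → M i j ≡ false → toℕ j ≤ toℕ t →
     ¬ IsAntiDiag l i t → M i t ≡ false)
  where open import Data.Product using (_×_)

module Submission where

-- Start from M and repeatedly move a single one inside a row, from a column
-- with surplus to a column with deficit.  Throughout, the row sums stay a,
-- the anti-diagonal ones stay in place, the column sums keep dominating b and
-- keep total sum(b).  If some column sum falls short of b, take the first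
-- such column j.  Domination forces an earlier column k with surplus, and the
-- prefix sums of the column sums exceed those of b strictly on (k, j].  Since
-- b is non-increasing, column k has at least two more ones than column j,
-- hence two rows with a one in column k and a zero in column j; at most one
-- of them has its anti-diagonal position in column k, so the other one can
-- move its one from k to j.  This lowers the prefix sums by one exactly on
-- (k, j], so domination survives, and the excess sum (c_t - b_t)^+ drops by
-- one.  When no column falls short, domination and equal totals give c = b.

open import Defs
open import Data.Nat using (ℕ; zero; suc; _+_; _*_; _∸_; _≤_; _<_; _≡ᵇ_; z≤n; s≤s; _≟_; _≤?_; _<?_)
open import Data.Nat.Properties
open import Data.Fin using (Fin; toℕ; fromℕ<) renaming (zero to fzero; suc to fsuc)
open import Data.Fin.Properties using (toℕ<n; toℕ-injective; toℕ-fromℕ<) renaming (suc-injective to fsuc-injective)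
open import Data.Bool using (Bool; true; false; _∧_; not; if_then_else_; T)
open import Data.Unit using (tt)
open import Data.Product using (Σ; ∃; _×_; _,_)
open import Data.Sum using (_⊎_; inj₁; inj₂; [_,_]′)
open import Data.Empty using (⊥-elim)
open import Function using (_∘_)
open import Relation.Nullary using (¬_; yes; no)
open import Relation.Unary using (Decidable)
open import Relation.Binary.PropositionalEquality
open import Algebra.Properties.CommutativeSemigroup +-commutativeSemigroup using (interchange)
open import Algebra.Properties.CommutativeMonoid.Sum +-0-commutativeMonoid using (sum; ∑-distrib-+)

sumF≡sum : ∀ {n} (f : Fin n → ℕ) → sumF f ≡ sum f
sumF≡sum {zero}  f = refl
sumF≡sum {suc n} f = cong (f fzero +_) (sumF≡sum (λ i → f (fsuc i)))

sumF-+ : ∀ {n} (f g : Fin n → ℕ) → sumF (λ i → f i + g i) ≡ sumF f + sumF g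
sumF-+ f g = begin
  sumF (λ i → f i + g i)  ≡⟨ sumF≡sum (λ i → f i + g i) ⟩
  sum (λ i → f i + g i)   ≡⟨ ∑-distrib-+ f g ⟩
  sum f + sum g           ≡⟨ sym (cong₂ _+_ (sumF≡sum f) (sumF≡sum g)) ⟩
  sumF f + sumF g         ∎
  where open ≡-Reasoning

sumF-cong : ∀ {n} {f g : Fin n → ℕ} → (∀ i → f i ≡ g i) → sumF f ≡ sumF g
sumF-cong {zero}  eq = refl
sumF-cong {suc n} eq = cong₂ _+_ (eq fzero) (sumF-cong (λ i → eq (fsuc i)))

sumF-mono : ∀ {n} {f g : Fin n → ℕ} → (∀ i → f i ≤ g i) → sumF f ≤ sumF g
sumF-mono {zero}  le = z≤n
sumF-mono {suc n} le = +-mono-≤ (le fzero) (sumF-mono (λ i → le (fsuc i)))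

sumF-zero : ∀ {n} {f : Fin n → ℕ} → (∀ i → f i ≡ 0) → sumF f ≡ 0
sumF-zero {zero}  eq = refl
sumF-zero {suc n} eq = cong₂ _+_ (eq fzero) (sumF-zero (λ i → eq (fsuc i)))

δ : ℕ → ℕ → ℕ
δ k m = val (m ≡ᵇ k)

δ-self : ∀ m → δ m m ≡ 1
δ-self zero    = refl
δ-self (suc m) = δ-self m

δ-other : ∀ {k m} → m ≢ k → δ k m ≡ 0
δ-other {zero}  {zero}  m≢k = ⊥-elim (m≢k refl)
δ-other {zero}  {suc m} m≢k = refl
δ-other {suc k} {zero}  m≢k = refl
δ-other {suc k} {suc m} m≢k = δ-other (λ m≡k → m≢k (cong suc m≡k))

sumF-indicator : ∀ {n} (p : Fin n) (c : ℕ) → sumF {n} (λ t → δ (toℕ p) (toℕ t) * c) ≡ c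
sumF-indicator {suc n} fzero    c = trans (cong₂ _+_ (+-identityʳ c) (sumF-zero {n} (λ _ → refl))) (+-identityʳ c)
sumF-indicator {suc n} (fsuc p) c = sumF-indicator p c

sumF-balance : ∀ {n} (f g : Fin n → ℕ) (p q : Fin n) (c d : ℕ) →
  (∀ t → f t + δ (toℕ p) (toℕ t) * c ≡ g t + δ (toℕ q) (toℕ t) * d) →
  sumF f + c ≡ sumF g + d
sumF-balance {n} f g p q c d eq = begin
  sumF f + c                       ≡⟨ cong (sumF f +_) (sym (sumF-indicator p c)) ⟩
  sumF f + sumF at-p               ≡⟨ sym (sumF-+ f at-p) ⟩
  sumF (λ t → f t + at-p t)        ≡⟨ sumF-cong eq ⟩
  sumF (λ t → g t + at-q t)        ≡⟨ sumF-+ g at-q ⟩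
  sumF g + sumF at-q               ≡⟨ cong (sumF g +_) (sumF-indicator q d) ⟩
  sumF g + d                       ∎
  where
  open ≡-Reasoning
  at-p at-q : Fin n → ℕ
  at-p t = δ (toℕ p) (toℕ t) * c
  at-q t = δ (toℕ q) (toℕ t) * d

ext-toℕ : ∀ {n} (f : Fin n → ℕ) (t : Fin n) → ext f (toℕ t) ≡ f t
ext-toℕ f fzero    = refl
ext-toℕ f (fsuc t) = ext-toℕ (λ i → f (fsuc i)) t

ext-fromℕ< : ∀ {n} (f : Fin n → ℕ) {m} (m<n : m < n) → ext f m ≡ f (fromℕ< m<n)
ext-fromℕ< {suc n} f {zero}  _         = refl
ext-fromℕ< {suc n} f {suc m} (s≤s m<n) = ext-fromℕ< (λ i → f (fsuc i)) m<n

ext-balance : ∀ {n} (f g : Fin n → ℕ) (p q : ℕ → ℕ) →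
  (∀ t → f t + p (toℕ t) ≡ g t + q (toℕ t)) → (∀ m → n ≤ m → p m ≡ q m) →
  ∀ m → ext f m + p m ≡ ext g m + q m
ext-balance {zero}  f g p q inside beyond m       = beyond m z≤n
ext-balance {suc n} f g p q inside beyond zero    = inside fzero
ext-balance {suc n} f g p q inside beyond (suc m) =
  ext-balance (λ i → f (fsuc i)) (λ i → g (fsuc i)) (λ x → p (suc x)) (λ x → q (suc x))
    (λ t → inside (fsuc t)) (λ x n≤x → beyond (suc x) (s≤s n≤x)) m

prefix : (ℕ → ℕ) → ℕ → ℕ
prefix D zero    = 0
prefix D (suc r) = prefix D r + D r

psum≡prefix : ∀ {n} (f : Fin n → ℕ) r → psum f r ≡ prefix (ext f) r
psum≡prefix f zero    = refl
psum≡prefix f (suc r) = cong (_+ ext f r) (psum≡prefix f r)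

sumF≡prefix : ∀ {n} (f : Fin n → ℕ) → sumF f ≡ prefix (ext f) n
sumF≡prefix {zero}  f = refl
sumF≡prefix {suc n} f = trans (cong (f fzero +_) (sumF≡prefix (λ i → f (fsuc i)))) (prefix-shift n)
  where
  prefix-shift : ∀ r → f fzero + prefix (ext (λ i → f (fsuc i))) r ≡ prefix (ext f) (suc r)
  prefix-shift zero    = +-identityʳ (f fzero)
  prefix-shift (suc r) = trans (sym (+-assoc (f fzero) _ _)) (cong (_+ ext f (suc r)) (prefix-shift r))

prefix-+ : ∀ (D E : ℕ → ℕ) r → prefix (λ m → D m + E m) r ≡ prefix D r + prefix E r
prefix-+ D E zero    = refl
prefix-+ D E (suc r) = trans (cong (_+ (D r + E r)) (prefix-+ D E r))
                             (interchange (prefix D r) (prefix E r) (D r) (E r))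

prefix-cong< : ∀ {D E : ℕ → ℕ} r → (∀ m → m < r → D m ≡ E m) → prefix D r ≡ prefix E r
prefix-cong< zero    eq = refl
prefix-cong< (suc r) eq = cong₂ _+_ (prefix-cong< r (λ m m<r → eq m (m<n⇒m<1+n m<r))) (eq r ≤-refl)

prefix-mono< : ∀ {D E : ℕ → ℕ} r → (∀ m → m < r → D m ≤ E m) → prefix D r ≤ prefix E r
prefix-mono< zero    le = z≤n
prefix-mono< (suc r) le = +-mono-≤ (prefix-mono< r (λ m m<r → le m (m<n⇒m<1+n m<r))) (le r ≤-refl)

prefix-δ-below : ∀ {k r} → r ≤ k → prefix (δ k) r ≡ 0
prefix-δ-below {k} {zero}  _   = refl
prefix-δ-below {k} {suc r} r<k =
  cong₂ _+_ (prefix-δ-below (<⇒≤ r<k)) (δ-other (<⇒≢ r<k))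

prefix-δ-above : ∀ {k r} → k < r → prefix (δ k) r ≡ 1
prefix-δ-above {k} {suc r} (s≤s k≤r) with k ≟ r
... | yes refl = cong₂ _+_ (prefix-δ-below {k} ≤-refl) (δ-self k)
... | no k≢r   = cong₂ _+_ (prefix-δ-above (≤∧≢⇒< k≤r k≢r)) (δ-other (k≢r ∘ sym))

prefix-strict-persists : ∀ {B D : ℕ → ℕ} {r} s → (∀ m → m < s → B m ≤ D m) → r ≤ s →
  prefix B r < prefix D r → prefix B s < prefix D s
prefix-strict-persists zero    le z≤n lt = lt
prefix-strict-persists (suc s) le r≤s lt with m≤n⇒m<n∨m≡n r≤s
... | inj₂ refl        = lt
... | inj₁ (s≤s r≤s′) =
  +-mono-<-≤ (prefix-strict-persists s (λ m m<s → le m (m<n⇒m<1+n m<s)) r≤s′ lt) (le s ≤-refl)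

+-tight : ∀ {a b c d} → a ≤ c → b ≤ d → c + d ≡ a + b → c ≡ a × d ≡ b
+-tight {a} {b} {c} {d} a≤c b≤d e = c≡a , +-cancelˡ-≡ c d b (trans e (cong (_+ b) (sym c≡a)))
  where
  c≡a : c ≡ a
  c≡a = ≤-antisym (+-cancelʳ-≤ d c a (≤-trans (≤-reflexive e) (+-monoʳ-≤ a b≤d))) a≤c

prefix-tight : ∀ {B D : ℕ → ℕ} n → (∀ m → m < n → B m ≤ D m) → prefix D n ≡ prefix B n →
  ∀ m → m < n → D m ≡ B m
prefix-tight (suc n) le eq m m<1+n
  with +-tight (prefix-mono< n (λ m m<n → le m (m<n⇒m<1+n m<n))) (le n ≤-refl) eq
... | prefixes-equal , last-equal with m≤n⇒m<n∨m≡n (≤-pred m<1+n)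
...   | inj₂ refl = last-equal
...   | inj₁ m<n  = prefix-tight n (λ m m<n → le m (m<n⇒m<1+n m<n)) prefixes-equal m m<n

-- D′ arises from D by moving one unit from position k to position j.
Moved : (D D′ : ℕ → ℕ) → ℕ → ℕ → Set
Moved D D′ k j = ∀ m → D′ m + δ k m ≡ D m + δ j m

module _ {D D′ : ℕ → ℕ} {k j : ℕ} (moved : Moved D D′ k j) (k<j : k < j) where

  moved-source : D′ k + 1 ≡ D k
  moved-source = trans (subst₂ (λ u v → D′ k + u ≡ D k + v) (δ-self k) (δ-other (<⇒≢ k<j)) (moved k))
                       (+-identityʳ (D k))

  moved-target : D′ j ≡ D j + 1
  moved-target = trans (sym (+-identityʳ (D′ j)))
    (subst₂ (λ u v → D′ j + u ≡ D j + v) (δ-other (<⇒≢ k<j ∘ sym)) (δ-self j) (moved j))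

  moved-elsewhere : ∀ {m} → m ≢ k → m ≢ j → D′ m ≡ D m
  moved-elsewhere {m} m≢k m≢j = +-cancelʳ-≡ 0 (D′ m) (D m)
    (subst₂ (λ u v → D′ m + u ≡ D m + v) (δ-other m≢k) (δ-other m≢j) (moved m))

  prefix-moved : ∀ r → prefix D′ r + prefix (δ k) r ≡ prefix D r + prefix (δ j) r
  prefix-moved r = begin
    prefix D′ r + prefix (δ k) r          ≡⟨ sym (prefix-+ D′ (δ k) r) ⟩
    prefix (λ m → D′ m + δ k m) r         ≡⟨ prefix-cong< r (λ m _ → moved m) ⟩
    prefix (λ m → D m + δ j m) r          ≡⟨ prefix-+ D (δ j) r ⟩
    prefix D r + prefix (δ j) r           ∎
    where open ≡-Reasoning

  prefix-moved-outside : ∀ r → r ≤ k ⊎ j < r → prefix D′ r ≡ prefix D r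
  prefix-moved-outside r (inj₁ r≤k) = +-cancelʳ-≡ 0 _ _
    (subst₂ (λ u v → prefix D′ r + u ≡ prefix D r + v)
      (prefix-δ-below r≤k) (prefix-δ-below (≤-trans r≤k (<⇒≤ k<j))) (prefix-moved r))
  prefix-moved-outside r (inj₂ j<r) = +-cancelʳ-≡ 1 _ _
    (subst₂ (λ u v → prefix D′ r + u ≡ prefix D r + v)
      (prefix-δ-above (<-trans k<j j<r)) (prefix-δ-above j<r) (prefix-moved r))

  prefix-moved-inside : ∀ r → k < r → r ≤ j → prefix D′ r + 1 ≡ prefix D r
  prefix-moved-inside r k<r r≤j = trans
    (subst₂ (λ u v → prefix D′ r + u ≡ prefix D r + v)
      (prefix-δ-above k<r) (prefix-δ-below r≤j) (prefix-moved r))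
    (+-identityʳ (prefix D r))

  moved-dominates : ∀ {B : ℕ → ℕ} → (∀ r → prefix B r ≤ prefix D r) →
    (∀ r → k < r → r ≤ j → prefix B r < prefix D r) → ∀ r → prefix B r ≤ prefix D′ r
  moved-dominates {B} dom strict r with r ≤? k | j <? r
  ... | yes r≤k | _       = subst (prefix B r ≤_) (sym (prefix-moved-outside r (inj₁ r≤k))) (dom r)
  ... | no _    | yes j<r = subst (prefix B r ≤_) (sym (prefix-moved-outside r (inj₂ j<r))) (dom r)
  ... | no r≰k  | no j≮r  = +-cancelʳ-≤ 1 (prefix B r) (prefix D′ r)
    (subst (prefix B r + 1 ≤_) (sym (prefix-moved-inside r (≰⇒> r≰k) (≮⇒≥ j≮r)))
      (subst (_≤ prefix D r) (+-comm 1 (prefix B r)) (strict r (≰⇒> r≰k) (≮⇒≥ j≮r))))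

  moved-excess : ∀ {B : ℕ → ℕ} {y} → B k < D k → D j < B j → j < y →
    prefix (λ m → D′ m ∸ B m) y + 1 ≡ prefix (λ m → D m ∸ B m) y
  moved-excess {B} {y} surplus deficit j<y = begin
    prefix (λ m → D′ m ∸ B m) y + 1               ≡⟨ cong (_ +_) (sym (prefix-δ-above (<-trans k<j j<y))) ⟩
    prefix (λ m → D′ m ∸ B m) y + prefix (δ k) y  ≡⟨ sym (prefix-+ (λ m → D′ m ∸ B m) (δ k) y) ⟩
    prefix (λ m → (D′ m ∸ B m) + δ k m) y         ≡⟨ prefix-cong< y (λ m _ → pointwise m) ⟩
    prefix (λ m → D m ∸ B m) y                    ∎
    where
    open ≡-Reasoning
    B≤D′ : B k ≤ D′ k
    B≤D′ = ≤-pred (≤-trans surplus (≤-reflexive (trans (sym moved-source) (+-comm (D′ k) 1))))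
    D′≤B : D′ j ≤ B j
    D′≤B = ≤-trans (≤-reflexive (trans moved-target (+-comm (D j) 1))) deficit
    pointwise : ∀ m → (D′ m ∸ B m) + δ k m ≡ D m ∸ B m
    pointwise m with m ≟ k | m ≟ j
    ... | yes refl | _        = begin
      (D′ k ∸ B k) + δ k k   ≡⟨ cong ((D′ k ∸ B k) +_) (δ-self k) ⟩
      (D′ k ∸ B k) + 1       ≡⟨ sym (+-∸-comm 1 B≤D′) ⟩
      (D′ k + 1) ∸ B k       ≡⟨ cong (_∸ B k) moved-source ⟩
      D k ∸ B k              ∎
    ... | no m≢k   | yes refl = begin
      (D′ j ∸ B j) + δ k j   ≡⟨ cong₂ _+_ (m≤n⇒m∸n≡0 D′≤B) (δ-other m≢k) ⟩
      0                      ≡⟨ sym (m≤n⇒m∸n≡0 (<⇒≤ deficit)) ⟩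
      D j ∸ B j              ∎
    ... | no m≢k   | no m≢j   = trans (cong₂ _+_ (cong (_∸ B m) (moved-elsewhere m≢k m≢j)) (δ-other m≢k))
                                      (+-identityʳ (D m ∸ B m))

least : ∀ {P : ℕ → Set} → Decidable P → ∀ n →
  (∃ λ m → m < n × P m × (∀ m′ → m′ < m → ¬ P m′)) ⊎ (∀ m → m < n → ¬ P m)
least P? zero = inj₂ (λ m ())
least P? (suc n) with least P? n
... | inj₁ (m , m<n , Pm , below) = inj₁ (m , m<n⇒m<1+n m<n , Pm , below)
... | inj₂ none with P? n
...   | yes Pn = inj₁ (n , ≤-refl , Pn , none)
...   | no ¬Pn = inj₂ (λ m m<1+n → [ none m , (λ { refl → ¬Pn }) ]′ (m≤n⇒m<n∨m≡n (≤-pred m<1+n)))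

transfer-source : ∀ {B D : ℕ → ℕ} {j} → (∀ r → prefix B r ≤ prefix D r) → D j < B j →
  (∀ m → m < j → ¬ D m < B m) →
  ∃ λ k → k < j × B k < D k × (∀ r → k < r → r ≤ j → prefix B r < prefix D r)
transfer-source {B} {D} {j} dom deficit first with anyUpTo? (λ m → B m <? D m) j
... | yes (k , k<j , surplus) = k , k<j , surplus , strict
  where
  strict : ∀ r → k < r → r ≤ j → prefix B r < prefix D r
  strict r k<r r≤j = prefix-strict-persists r (λ m m<r → ≮⇒≥ (first m (<-≤-trans m<r r≤j))) k<r
                       (+-mono-≤-< (dom k) surplus)
... | no no-surplus = ⊥-elim (<⇒≱ overtaken (dom (suc j)))
  where
  balanced : ∀ m → m < j → D m ≡ B m
  balanced m m<j = ≤-antisym (≮⇒≥ (λ lt → no-surplus (m , m<j , lt))) (≮⇒≥ (first m m<j))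
  overtaken : prefix D (suc j) < prefix B (suc j)
  overtaken = subst (λ x → x + D j < prefix B j + B j) (sym (prefix-cong< j balanced))
                (+-monoʳ-< (prefix B j) deficit)

count : ∀ {n} → (Fin n → Bool) → ℕ
count h = sumF (λ i → val (h i))

count-split : ∀ {n} (f g : Fin n → Bool) → count f ≤ count g + count (λ i → f i ∧ not (g i))
count-split f g = ≤-trans (sumF-mono pointwise) (≤-reflexive (sumF-+ (λ i → val (g i)) _))
  where
  pointwise : ∀ i → val (f i) ≤ val (g i) + val (f i ∧ not (g i))
  pointwise i with f i | g i
  ... | true  | true  = s≤s z≤n
  ... | true  | false = s≤s z≤n
  ... | false | _     = z≤n

some-true : ∀ {n} (h : Fin n → Bool) → 1 ≤ count h → ∃ λ i → h i ≡ true
some-true {suc n} h pos with h fzero in h₀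
... | true  = fzero , h₀
... | false with some-true (λ i → h (fsuc i)) pos
...   | i , hi = fsuc i , hi

two-trues : ∀ {n} (h : Fin n → Bool) → 2 ≤ count h →
  ∃ λ i → ∃ λ i′ → i ≢ i′ × h i ≡ true × h i′ ≡ true
two-trues {suc n} h two with h fzero in h₀
... | true with some-true (λ i → h (fsuc i)) (≤-pred two)
...   | i , hi = fzero , fsuc i , (λ ()) , h₀ , hi
two-trues {suc n} h two | false with two-trues (λ i → h (fsuc i)) two
...   | i , i′ , i≢i′ , hi , hi′ = fsuc i , fsuc i′ , (i≢i′ ∘ fsuc-injective) , hi , hi′

∧-not-true : ∀ {u v : Bool} → u ∧ not v ≡ true → u ≡ true × v ≡ false
∧-not-true {true} {false} _ = refl , refl

antiDiag-unique : ∀ {l y} {i i′ : Fin l} {t : Fin y} → IsAntiDiag l i t → IsAntiDiag l i′ t → i ≡ i′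
antiDiag-unique {i = i} {i′} d d′ =
  toℕ-injective (suc-injective (∸-cancelˡ-≡ (toℕ<n i) (toℕ<n i′) (trans (sym d) d′)))

movable-row : ∀ {l y} (N : Matrix01 l y) (k j : Fin y) → 2 + colSum N j ≤ colSum N k →
  ∃ λ i₀ → N i₀ k ≡ true × N i₀ j ≡ false × ¬ IsAntiDiag l i₀ k
movable-row {l} N k j gap with two-trues candidate enough
  where
  candidate : Fin l → Bool
  candidate i = N i k ∧ not (N i j)
  enough : 2 ≤ count candidate
  enough = +-cancelˡ-≤ (colSum N j) 2 _ (≤-trans (≤-reflexive (+-comm (colSum N j) 2))
             (≤-trans gap (count-split (λ i → N i k) (λ i → N i j))))
... | i , i′ , i≢i′ , ci , ci′ with toℕ k ≟ l ∸ suc (toℕ i)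
...   | no off  = let (in-k , out-j) = ∧-not-true ci in i , in-k , out-j , off
...   | yes on  = let (in-k , out-j) = ∧-not-true ci′ in
                  i′ , in-k , out-j , (λ on′ → i≢i′ (antiDiag-unique on on′))

≡ᵇ-true : ∀ {m n} → (m ≡ᵇ n) ≡ true → m ≡ n
≡ᵇ-true {m} {n} e = ≡ᵇ⇒≡ m n (subst T (sym e) tt)

fin-≡ᵇ-true : ∀ {n} {s t : Fin n} → (toℕ s ≡ᵇ toℕ t) ≡ true → s ≡ t
fin-≡ᵇ-true e = toℕ-injective (≡ᵇ-true e)

move : ∀ {l y} → Matrix01 l y → Fin l → Fin y → Fin y → Matrix01 l y
move N i₀ k j i t =
  if toℕ i ≡ᵇ toℕ i₀
  then (if toℕ t ≡ᵇ toℕ k then false else if toℕ t ≡ᵇ toℕ j then true else N i t)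
  else N i t

module Move {l y} (N : Matrix01 l y) (i₀ : Fin l) (k j : Fin y)
  (one-at-k : N i₀ k ≡ true) (zero-at-j : N i₀ j ≡ false) (k≢j : toℕ k ≢ toℕ j) where

  N′ : Matrix01 l y
  N′ = move N i₀ k j

  move-entry : ∀ i t → val (N′ i t) + δ (toℕ i₀) (toℕ i) * δ (toℕ k) (toℕ t)
                     ≡ val (N i t) + δ (toℕ i₀) (toℕ i) * δ (toℕ j) (toℕ t)
  move-entry i t with toℕ i ≡ᵇ toℕ i₀ in i≡i₀ | toℕ t ≡ᵇ toℕ k in t≡k | toℕ t ≡ᵇ toℕ j in t≡j
  ... | false | _     | _     = refl
  ... | true  | true  | true  = ⊥-elim (k≢j (trans (sym (≡ᵇ-true {toℕ t} t≡k)) (≡ᵇ-true {toℕ t} t≡j)))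
  ... | true  | true  | false =
    sym (cong (λ b → val b + 0) (trans (cong₂ N (fin-≡ᵇ-true i≡i₀) (fin-≡ᵇ-true t≡k)) one-at-k))
  ... | true  | false | true  =
    sym (cong (λ b → val b + 1) (trans (cong₂ N (fin-≡ᵇ-true i≡i₀) (fin-≡ᵇ-true t≡j)) zero-at-j))
  ... | true  | false | false = refl

  rowSum-move : ∀ i → rowSum N′ i ≡ rowSum N i
  rowSum-move i = +-cancelʳ-≡ c _ _ (sumF-balance _ _ k j c c λ t →
    trans (cong (val (N′ i t) +_) (*-comm _ c)) (trans (move-entry i t) (cong (val (N i t) +_) (*-comm c _))))
    where
    c : ℕ
    c = δ (toℕ i₀) (toℕ i)

  colSum-move : ∀ t → colSum N′ t + δ (toℕ k) (toℕ t) ≡ colSum N t + δ (toℕ j) (toℕ t)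
  colSum-move t = sumF-balance _ _ i₀ i₀ _ _ (λ i → move-entry i t)

  antiDiag-move : ¬ IsAntiDiag l i₀ k → HasAntiDiagOnes N → HasAntiDiagOnes N′
  antiDiag-move off-diag ones i t on with toℕ i ≡ᵇ toℕ i₀ in i≡i₀ | toℕ t ≡ᵇ toℕ k in t≡k | toℕ t ≡ᵇ toℕ j
  ... | false | _     | _     = ones i t on
  ... | true  | true  | _     =
    ⊥-elim (off-diag (subst₂ (IsAntiDiag l) (fin-≡ᵇ-true i≡i₀) (fin-≡ᵇ-true t≡k) on))
  ... | true  | false | true  = refl
  ... | true  | false | false = ones i t on

module Realisation {l y : ℕ} (a : Fin l → ℕ) (b : Fin y → ℕ) (b-nonIncreasing : NonIncreasing b) where

  B : ℕ → ℕ
  B = ext b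

  cols : Matrix01 l y → ℕ → ℕ
  cols N = ext (colSum N)

  Solution : Set
  Solution = Σ (Matrix01 l y) (λ M′ →
    (∀ i → rowSum M′ i ≡ a i) × (∀ j → colSum M′ j ≡ b j) × HasAntiDiagOnes M′)

  record Invariant (N : Matrix01 l y) : Set where
    field
      rows      : ∀ i → rowSum N i ≡ a i
      antiDiag  : HasAntiDiagOnes N
      dominates : ∀ r → prefix B r ≤ prefix (cols N) r
      total     : prefix (cols N) y ≡ prefix B y
  open Invariant

  -- Total amount by which the column sums exceed b; it bounds the iteration.
  excess : Matrix01 l y → ℕ
  excess N = prefix (λ m → cols N m ∸ B m) y

  B-antitone : ∀ {k j} → k < j → j < y → B j ≤ B k
  B-antitone {k} {j} k<j j<y = subst₂ _≤_ (sym (ext-fromℕ< b j<y)) (sym (ext-fromℕ< b k<y))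
    (b-nonIncreasing (fromℕ< k<y) (fromℕ< j<y)
      (subst₂ _≤_ (sym (toℕ-fromℕ< k<y)) (sym (toℕ-fromℕ< j<y)) (<⇒≤ k<j)))
    where
    k<y : k < y
    k<y = <-trans k<j j<y

  solved : ∀ N → Invariant N → (∀ m → m < y → ¬ cols N m < B m) → Solution
  solved N inv no-deficit = N , rows inv , column , antiDiag inv
    where
    equal : ∀ m → m < y → cols N m ≡ B m
    equal = prefix-tight y (λ m m<y → ≮⇒≥ (no-deficit m m<y)) (total inv)
    column : ∀ t → colSum N t ≡ b t
    column t = trans (sym (ext-toℕ (colSum N) t)) (trans (equal (toℕ t) (toℕ<n t)) (ext-toℕ b t))

  transfer-step : ∀ N {k j} → Invariant N → k < j → j < y → B k < cols N k → cols N j < B j →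
    (∀ r → k < r → r ≤ j → prefix B r < prefix (cols N) r) →
    ∃ λ N′ → Invariant N′ × suc (excess N′) ≡ excess N
  transfer-step N {k} {j} inv k<j j<y surplus deficit strict = apply (movable-row N fk fj gap)
    where
    k<y : k < y
    k<y = <-trans k<j j<y
    fk fj : Fin y
    fk = fromℕ< k<y
    fj = fromℕ< j<y
    k≢j : toℕ fk ≢ toℕ fj
    k≢j e = <⇒≢ k<j (trans (sym (toℕ-fromℕ< k<y)) (trans e (toℕ-fromℕ< j<y)))
    gap : 2 + colSum N fj ≤ colSum N fk
    gap = subst₂ (λ u v → 2 + u ≤ v) (ext-fromℕ< (colSum N) j<y) (ext-fromℕ< (colSum N) k<y)
            (≤-trans (s≤s (≤-trans deficit (B-antitone k<j j<y))) surplus)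
    apply : (∃ λ i₀ → N i₀ fk ≡ true × N i₀ fj ≡ false × ¬ IsAntiDiag l i₀ fk) →
            ∃ λ N′ → Invariant N′ × suc (excess N′) ≡ excess N
    apply (i₀ , one-at-k , zero-at-j , off-diag) = N′ , invariant′ , decrease
      where
      open Move N i₀ fk fj one-at-k zero-at-j k≢j
      moved : Moved (cols N) (cols N′) k j
      moved = ext-balance (colSum N′) (colSum N) (δ k) (δ j)
        (λ t → subst₂ (λ u v → colSum N′ t + δ u (toℕ t) ≡ colSum N t + δ v (toℕ t))
                 (toℕ-fromℕ< k<y) (toℕ-fromℕ< j<y) (colSum-move t))
        (λ m y≤m → trans (δ-other (<⇒≢ (<-≤-trans k<y y≤m) ∘ sym))
                         (sym (δ-other (<⇒≢ (<-≤-trans j<y y≤m) ∘ sym))))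
      invariant′ : Invariant N′
      invariant′ = record
        { rows      = λ i → trans (rowSum-move i) (rows inv i)
        ; antiDiag  = antiDiag-move off-diag (antiDiag inv)
        ; dominates = moved-dominates moved k<j (dominates inv) strict
        ; total     = trans (prefix-moved-outside moved k<j y (inj₂ j<y)) (total inv)
        }
      decrease : suc (excess N′) ≡ excess N
      decrease = trans (+-comm 1 (excess N′)) (moved-excess moved k<j surplus deficit j<y)

  improve : ∀ N {j} → Invariant N → j < y → cols N j < B j → (∀ m → m < j → ¬ cols N m < B m) →
    ∃ λ N′ → Invariant N′ × suc (excess N′) ≡ excess N
  improve N inv j<y deficit first with transfer-source (dominates inv) deficit first
  ... | k , k<j , surplus , strict = transfer-step N inv k<j j<y surplus deficit strict

  -- Fuel n bounds the excess; each step lowers the excess by one.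
  iterate : ∀ n N → Invariant N → excess N ≤ n → Solution
  descend : ∀ n {N} → (∃ λ N′ → Invariant N′ × suc (excess N′) ≡ excess N) → excess N ≤ n → Solution

  iterate n N inv bound with least (λ m → cols N m <? B m) y
  ... | inj₂ no-deficit                 = solved N inv no-deficit
  ... | inj₁ (j , j<y , deficit , first) = descend n (improve N inv j<y deficit first) bound

  descend zero    (N′ , _    , decrease) bound = ⊥-elim (n≮0 (subst (_≤ 0) (sym decrease) bound))
  descend (suc n) (N′ , inv′ , decrease) bound =
    iterate n N′ inv′ (≤-pred (subst (_≤ suc n) (sym decrease) bound))

theorem2 : (l y : ℕ) → 1 ≤ l → l ≤ y →
    (a : Fin l → ℕ) → (b : Fin y → ℕ) →
    NonIncreasing a → (∀ i → 1 ≤ a i) → NonIncreasing b →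
    sumF a ≡ sumF b →
    (M : Matrix01 l y) → IsModifiedFerrers M a →
    colSum M ⊵ b →
    Σ (Matrix01 l y) (λ M′ →
      (∀ i → rowSum M′ i ≡ a i) × (∀ j → colSum M′ j ≡ b j) × HasAntiDiagOnes M′)
theorem2 l y _ _ a b _ _ b-nonIncreasing _ M (rows , antiDiag , _) (equal-sums , prefix-dominated) =
  iterate (excess M) M initial ≤-refl
  where
  open Realisation a b b-nonIncreasing
  dominates : ∀ r → prefix (ext b) r ≤ prefix (ext (colSum M)) r
  dominates zero    = z≤n
  dominates (suc r) = subst₂ _≤_ (psum≡prefix b (suc r)) (psum≡prefix (colSum M) (suc r))
                        (prefix-dominated (suc r) (s≤s z≤n))
  initial : Invariant M
  initial = record
    { rows      = rows
    ; antiDiag  = antiDiag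
    ; dominates = dominates
    ; total     = trans (sym (sumF≡prefix (colSum M))) (trans equal-sums (sumF≡prefix b))
    }
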